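{- For every integer $n \ge 2$: (i) $D_n = h_4(n)$, and (ii) $D_{n+1} - D_n = h_2(n)$.
   Context: For a binary sequence $x = (x_1,\dots,x_n) \in \{0,1\}^n$ (1 = heads, 0 = tails) define the score $$S(x) = \sum_{i=1}^{n-1} I[x_i = x_{i+1} = 1] - \sum_{i=1}^{n-1} I[x_i = 1,\ x_{i+1} = 0].$$ Let $$D_n = \#\{x \in \{0,1\}^n : S(x) < 0\} - \#\{x \in \{0,1\}^n : S(x) > 0\}.$$ Let $h_2(n)$ be the number of $x \in \{0,1\}^n$ with $x_n = 1$ and $S(x) = 1$, and $h_4(n)$ the number of $x \in \{0,1\}^n$ with $x_n = 1$ and $S(x) = -1$. -}

module Defs where

open import Data.Bool using (Bool; true; false)
open import Data.Nat using (ℕ; zero; suc)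
open import Data.Integer using (ℤ; +_; _-_; _+_; _<_; _>_; _≟_)
open import Data.Integer.Properties using () renaming (_<?_ to _<ℤ?_)
open import Data.List using (List; []; _∷_; _++_; map; length; filter; concatMap)
open import Data.Vec using (Vec; []; _∷_; last)
open import Relation.Nullary using (Dec; yes; no)
open import Data.Product using (_×_; _,_)
open import Relation.Nullary.Decidable using (_×-dec_)
open import Relation.Binary.PropositionalEquality using (_≡_)
import Data.Bool.Properties as BP

-- All binary sequences of length n (true = heads = 1, false = tails = 0).
allSeqs : (n : ℕ) → List (Vec Bool n)
allSeqs zero = [] ∷ []
allSeqs (suc n) = map (true ∷_) (allSeqs n) ++ map (false ∷_) (allSeqs n)

pairScore : Bool → Bool → ℤ
pairScore true  true  = + 1
pairScore true  false = Data.Integer.-[1+ 0 ]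
pairScore false _     = + 0

S : {n : ℕ} → Vec Bool n → ℤ
S [] = + 0
S (x ∷ []) = + 0
S (x ∷ y ∷ xs) = pairScore x y + S (y ∷ xs)

D : ℕ → ℤ
D n = (+ length (filter (λ x → S x <ℤ? + 0) (allSeqs n)))
    - (+ length (filter (λ x → + 0 <ℤ? S x) (allSeqs n)))

-- last element of a sequence of length ≥ 1 is heads (x_n = 1); false for n = 0
lastIsHeads : {n : ℕ} → Vec Bool n → Bool
lastIsHeads [] = false
lastIsHeads (x ∷ []) = x
lastIsHeads (x ∷ y ∷ xs) = lastIsHeads (y ∷ xs)

h₂ : ℕ → ℕ
h₂ n = length (filter (λ x → (lastIsHeads x BP.≟ true) ×-dec (S x ≟ + 1)) (allSeqs n))

h₄ : ℕ → ℕ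
h₄ n = length (filter (λ x → (lastIsHeads x BP.≟ true) ×-dec (S x ≟ Data.Integer.-[1+ 0 ])) (allSeqs n))

{-# OPTIONS --safe #-}
-- A sequence enters S, D, h₂ and h₄ only through its statistic (last bit, #HH, #HT), with
-- S = #HH − #HT, and appending a bit updates this statistic by a fixed rule. A sum over
-- {0,1}ⁿ⁺¹ of a function of the statistic is therefore a sum over {0,1}ⁿ of a transformed
-- function; for the indicators of S < 0 and S > 0 this yields D(n+1) = 2 D(n) − h₄(n) + h₂(n).
-- The sequences ending in 1 with u HH-pairs and d HT-pairs number C(u+d, d) · C(n−u−d−1, d):
-- the u+d+1 heads form d+1 runs, and the tails fill the d inner gaps and the front. Since
-- h₄ and h₂ collect the statistics (e, e+1) and (e+1, e), Pascal's rule in n together with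
-- C(2e+1, e+1) = C(2e+1, e) gives h₄(n+1) = h₄(n) + h₂(n), and D(n) = h₄(n) follows by
-- induction for every n.
module Submission where

open import Defs
open import Algebra.Properties.CommutativeSemigroup using (interchange; x∙yz≈y∙xz)
open import Data.Bool using (Bool; true; false; not; _∧_)
import Data.Bool.Properties as Bool
open import Data.Integer using (ℤ; +_; -[1+_]; _⊖_; _-_) renaming (_+_ to _+ℤ_)
import Data.Integer.Properties as ℤ
open import Data.Integer.Tactic.RingSolver using (solve-∀)
open import Data.List using (List; []; _∷_; _++_; map; filter; length)
open import Data.List.Properties using (map-++; map-∘; map-cong)
open import Data.Nat using (ℕ; zero; suc; _+_; _*_; _≤_; _<_; _≥_; z≤n; s≤s; _<ᵇ_; _≡ᵇ_)
open import Data.Nat.Combinatorics using (_C_; nCk+nC[k+1]≡[n+1]C[k+1]; nCk≡nC[n∸k]; nCn≡1)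
open import Data.Nat.ListAction using (sum)
open import Data.Nat.ListAction.Properties using (sum-++)
open import Data.Nat.Properties
  using (+-comm; +-identityʳ; +-suc; *-zeroʳ; *-distribˡ-+; *-distribʳ-+; +-mono-≤; ≤-<-trans;
         m≤n+m; m+n∸n≡m; n<1+n; m<n⇒m<1+n; +-commutativeSemigroup)
open import Data.Product using (_×_; _,_)
open import Data.Vec using (Vec; []; _∷_; _∷ʳ_)
open import Function using (_∘_; id)
open import Relation.Nullary using (Dec; does)
open import Relation.Binary.PropositionalEquality using (_≡_; refl; sym; trans; cong; cong₂; module ≡-Reasoning)

open ≡-Reasoning

𝟙 : Bool → ℕ
𝟙 true  = 1
𝟙 false = 0

𝟙≤1 : ∀ b → 𝟙 b ≤ 1
𝟙≤1 true  = s≤s z≤n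
𝟙≤1 false = z≤n

sum-map-+ : ∀ {a} {A : Set a} (f g : A → ℕ) (xs : List A) →
            sum (map (λ x → f x + g x) xs) ≡ sum (map f xs) + sum (map g xs)
sum-map-+ f g []       = refl
sum-map-+ f g (x ∷ xs) =
  trans (cong (_+_ (f x + g x)) (sum-map-+ f g xs)) (interchange +-commutativeSemigroup (f x) (g x) _ _)

length-filter≡sum : ∀ {a p} {A : Set a} {P : A → Set p} (P? : ∀ x → Dec (P x)) (xs : List A) →
                    length (filter P? xs) ≡ sum (map (𝟙 ∘ does ∘ P?) xs)
length-filter≡sum P? []       = refl
length-filter≡sum P? (x ∷ xs) with does (P? x)
... | true  = cong suc (length-filter≡sum P? xs)
... | false = length-filter≡sum P? xs

∑ : (n : ℕ) → (Vec Bool n → ℕ) → ℕ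
∑ n f = sum (map f (allSeqs n))

∑-cong : ∀ n {f g : Vec Bool n → ℕ} → (∀ x → f x ≡ g x) → ∑ n f ≡ ∑ n g
∑-cong n f≗g = cong sum (map-cong f≗g (allSeqs n))

∑-+ : ∀ n (f g : Vec Bool n → ℕ) → ∑ n (λ x → f x + g x) ≡ ∑ n f + ∑ n g
∑-+ n f g = sum-map-+ f g (allSeqs n)

∑-∷ : ∀ n (f : Vec Bool (suc n) → ℕ) → ∑ (suc n) f ≡ ∑ n (f ∘ (true ∷_)) + ∑ n (f ∘ (false ∷_))
∑-∷ n f = begin
  sum (map f (heads ++ tails))                  ≡⟨ cong sum (map-++ f heads tails) ⟩
  sum (map f heads ++ map f tails)              ≡⟨ sum-++ (map f heads) (map f tails) ⟩
  sum (map f heads) + sum (map f tails)         ≡⟨ cong₂ _+_ (cong sum (map-∘ xs)) (cong sum (map-∘ xs)) ⟨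
  ∑ n (f ∘ (true ∷_)) + ∑ n (f ∘ (false ∷_))    ∎
  where
  xs    = allSeqs n
  heads = map (true ∷_) xs
  tails = map (false ∷_) xs

∑-zero : ∀ n → ∑ n (λ _ → 0) ≡ 0
∑-zero zero    = refl
∑-zero (suc n) = trans (∑-∷ n _) (cong₂ _+_ (∑-zero n) (∑-zero n))

∑-∷ʳ : ∀ n (f : Vec Bool (suc n) → ℕ) → ∑ (suc n) f ≡ ∑ n (λ x → f (x ∷ʳ true)) + ∑ n (λ x → f (x ∷ʳ false))
∑-∷ʳ zero    f = ∑-∷ zero f
∑-∷ʳ (suc n) f = begin
  ∑ (suc (suc n)) f                                                    ≡⟨ ∑-∷ (suc n) f ⟩
  ∑ (suc n) (f ∘ (true ∷_)) + ∑ (suc n) (f ∘ (false ∷_))               ≡⟨ cong₂ _+_ (∑-∷ʳ n _) (∑-∷ʳ n _) ⟩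
  (part true true + part true false) + (part false true + part false false)
    ≡⟨ interchange +-commutativeSemigroup (part true true) _ _ _ ⟩
  (part true true + part false true) + (part true false + part false false)
    ≡⟨ cong₂ _+_ (∑-∷ n _) (∑-∷ n _) ⟨
  ∑ (suc n) (λ x → f (x ∷ʳ true)) + ∑ (suc n) (λ x → f (x ∷ʳ false))  ∎
  where
  part : Bool → Bool → ℕ
  part a b = ∑ n (λ x → f (a ∷ (x ∷ʳ b)))

headPairs : (Bool → Bool) → {n : ℕ} → Vec Bool n → ℕ
headPairs q []           = 0
headPairs q (x ∷ [])     = 0
headPairs q (x ∷ y ∷ xs) = 𝟙 (x ∧ q y) + headPairs q (y ∷ xs)

#HH #HT : {n : ℕ} → Vec Bool n → ℕ
#HH = headPairs id
#HT = headPairs not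

headPairs≤length : ∀ q {n} (x : Vec Bool n) → headPairs q x ≤ n
headPairs≤length q []           = z≤n
headPairs≤length q (x ∷ [])     = z≤n
headPairs≤length q (x ∷ y ∷ xs) = +-mono-≤ (𝟙≤1 (x ∧ q y)) (headPairs≤length q (y ∷ xs))

headPairs-∷ʳ : ∀ q {n} (x : Vec Bool n) b → headPairs q (x ∷ʳ b) ≡ 𝟙 (lastIsHeads x ∧ q b) + headPairs q x
headPairs-∷ʳ q []           b = refl
headPairs-∷ʳ q (x ∷ [])     b = refl
headPairs-∷ʳ q (x ∷ y ∷ xs) b =
  trans (cong (_+_ (𝟙 (x ∧ q y))) (headPairs-∷ʳ q (y ∷ xs) b))
        (x∙yz≈y∙xz +-commutativeSemigroup (𝟙 (x ∧ q y)) (𝟙 (lastIsHeads (y ∷ xs) ∧ q b)) _)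

lastIsHeads-∷ʳ : ∀ {n} (x : Vec Bool n) b → lastIsHeads (x ∷ʳ b) ≡ b
lastIsHeads-∷ʳ []           b = refl
lastIsHeads-∷ʳ (x ∷ [])     b = refl
lastIsHeads-∷ʳ (x ∷ y ∷ xs) b = lastIsHeads-∷ʳ (y ∷ xs) b

pairScore-+ : ∀ a b m n → pairScore a b +ℤ (m ⊖ n) ≡ (𝟙 (a ∧ b) + m) ⊖ (𝟙 (a ∧ not b) + n)
pairScore-+ true  true  = ℤ.distribʳ-⊖-+-pos 1
pairScore-+ true  false = ℤ.distribʳ-⊖-+-neg 0
pairScore-+ false b m n = ℤ.+-identityˡ (m ⊖ n)

S≡#HH⊖#HT : ∀ {n} (x : Vec Bool n) → S x ≡ #HH x ⊖ #HT x
S≡#HH⊖#HT []           = refl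
S≡#HH⊖#HT (x ∷ [])     = refl
S≡#HH⊖#HT (x ∷ y ∷ xs) = trans (cong (pairScore x y +ℤ_) (S≡#HH⊖#HT (y ∷ xs))) (pairScore-+ x y _ _)

Stat : Set
Stat = Bool × ℕ × ℕ

stat : ∀ {n} → Vec Bool n → Stat
stat x = lastIsHeads x , #HH x , #HT x

next : Stat → Bool → Stat
next (l , h , t) b = b , 𝟙 (l ∧ b) + h , 𝟙 (l ∧ not b) + t

stat-∷ʳ : ∀ {n} (x : Vec Bool n) b → stat (x ∷ʳ b) ≡ next (stat x) b
stat-∷ʳ x b = cong₂ _,_ (lastIsHeads-∷ʳ x b) (cong₂ _,_ (headPairs-∷ʳ id x b) (headPairs-∷ʳ not x b))

Weight : Set
Weight = Stat → ℕ

total : ℕ → Weight → ℕ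
total n F = ∑ n (F ∘ stat)

transfer : Weight → Weight
transfer F s = F (next s true) + F (next s false)

total-cong : ∀ n {F G : Weight} → (∀ s → F s ≡ G s) → total n F ≡ total n G
total-cong n F≗G = ∑-cong n (F≗G ∘ stat)

total-cong-≤ : ∀ n {F G : Weight} → (∀ l h t → h ≤ n → t ≤ n → F (l , h , t) ≡ G (l , h , t)) →
               total n F ≡ total n G
total-cong-≤ n F≗G = ∑-cong n λ x →
  F≗G (lastIsHeads x) (#HH x) (#HT x) (headPairs≤length id x) (headPairs≤length not x)

total-+ : ∀ n (F G : Weight) → total n (λ s → F s + G s) ≡ total n F + total n G
total-+ n F G = ∑-+ n (F ∘ stat) (G ∘ stat)

total-transfer : ∀ n F → total (suc n) F ≡ total n (transfer F)
total-transfer n F = begin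
  ∑ (suc n) (F ∘ stat)                                                    ≡⟨ ∑-∷ʳ n (F ∘ stat) ⟩
  ∑ n (λ x → F (stat (x ∷ʳ true))) + ∑ n (λ x → F (stat (x ∷ʳ false)))    ≡⟨ ∑-+ n _ _ ⟨
  ∑ n (λ x → F (stat (x ∷ʳ true)) + F (stat (x ∷ʳ false)))                ≡⟨ ∑-cong n appended ⟩
  total n (transfer F)                                                    ∎
  where
  appended : ∀ x → F (stat (x ∷ʳ true)) + F (stat (x ∷ʳ false)) ≡ transfer F (stat x)
  appended x = cong₂ _+_ (cong F (stat-∷ʳ x true)) (cong F (stat-∷ʳ x false))

length-filter≡total : ∀ n {P : Vec Bool n → Set} (P? : ∀ x → Dec (P x)) (F : Weight) →
                      (∀ x → 𝟙 (does (P? x)) ≡ F (stat x)) → length (filter P? (allSeqs n)) ≡ total n F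
length-filter≡total n P? F P≗F = trans (length-filter≡sum P? (allSeqs n)) (∑-cong n P≗F)

∑< : ℕ → (ℕ → ℕ) → ℕ
∑< zero    f = 0
∑< (suc K) f = f 0 + ∑< K (f ∘ suc)

∑<-cong : ∀ K {f g : ℕ → ℕ} → (∀ e → f e ≡ g e) → ∑< K f ≡ ∑< K g
∑<-cong zero    f≗g = refl
∑<-cong (suc K) f≗g = cong₂ _+_ (f≗g 0) (∑<-cong K (f≗g ∘ suc))

∑<-zero : ∀ K → ∑< K (λ _ → 0) ≡ 0
∑<-zero zero    = refl
∑<-zero (suc K) = ∑<-zero K

∑<-+ : ∀ K (f g : ℕ → ℕ) → ∑< K (λ e → f e + g e) ≡ ∑< K f + ∑< K g
∑<-+ zero    f g = refl
∑<-+ (suc K) f g =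
  trans (cong (_+_ (f 0 + g 0)) (∑<-+ K (f ∘ suc) (g ∘ suc)))
        (interchange +-commutativeSemigroup (f 0) (g 0) _ _)

∑<-δ : ∀ {h K} (p : ℕ → Bool) → h < K → ∑< K (λ e → 𝟙 ((h ≡ᵇ e) ∧ p e)) ≡ 𝟙 (p h)
∑<-δ {zero}  {suc K} p _         = trans (cong (_+_ (𝟙 (p 0))) (∑<-zero K)) (+-identityʳ _)
∑<-δ {suc h} {suc K} p (s≤s h<K) = ∑<-δ (p ∘ suc) h<K

total-∑< : ∀ n K (G : ℕ → Weight) → total n (λ s → ∑< K (λ e → G e s)) ≡ ∑< K (λ e → total n (G e))
total-∑< n zero    G = ∑-zero n
total-∑< n (suc K) G =
  trans (total-+ n (G 0) (λ s → ∑< K (λ e → G (suc e) s)))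
        (cong (_+_ (total n (G 0))) (total-∑< n K (G ∘ suc)))

δ : Stat → Weight
δ (l , u , d) (l′ , h , t) = 𝟙 (does (l′ Bool.≟ l) ∧ (h ≡ᵇ u) ∧ (t ≡ᵇ d))

count : ℕ → Stat → ℕ
count n s = total n (δ s)

count-suc₁ : ∀ n {s s₁} → (∀ r → transfer (δ s) r ≡ δ s₁ r) → count (suc n) s ≡ count n s₁
count-suc₁ n {s} split = trans (total-transfer n (δ s)) (total-cong n split)

count-suc₂ : ∀ n {s s₁ s₂} → (∀ r → transfer (δ s) r ≡ δ s₁ r + δ s₂ r) →
             count (suc n) s ≡ count n s₁ + count n s₂
count-suc₂ n {s} {s₁} {s₂} split =
  trans (total-transfer n (δ s)) (trans (total-cong n split) (total-+ n (δ s₁) (δ s₂)))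

count-suc-true-zero : ∀ n d → count (suc n) (true , 0 , d) ≡ count n (false , 0 , d)
count-suc-true-zero n d = count-suc₁ n split
  where
  split : ∀ r → transfer (δ (true , 0 , d)) r ≡ δ (false , 0 , d) r
  split (true  , h , t) = refl
  split (false , h , t) = +-identityʳ _

count-suc-true-suc : ∀ n u d →
  count (suc n) (true , suc u , d) ≡ count n (true , u , d) + count n (false , suc u , d)
count-suc-true-suc n u d = count-suc₂ n split
  where
  split : ∀ r → transfer (δ (true , suc u , d)) r ≡ δ (true , u , d) r + δ (false , suc u , d) r
  split (true  , h , t) = refl
  split (false , h , t) = +-identityʳ _

count-suc-false-zero : ∀ n u → count (suc n) (false , u , 0) ≡ count n (false , u , 0)
count-suc-false-zero n u = count-suc₁ n split
  where
  split : ∀ r → transfer (δ (false , u , 0)) r ≡ δ (false , u , 0) r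
  split (true  , h , t) = cong 𝟙 (Bool.∧-zeroʳ (h ≡ᵇ u))
  split (false , h , t) = refl

count-suc-false-suc : ∀ n u d →
  count (suc n) (false , u , suc d) ≡ count n (true , u , d) + count n (false , u , suc d)
count-suc-false-suc n u d = count-suc₂ n split
  where
  split : ∀ r → transfer (δ (false , u , suc d)) r ≡ δ (true , u , d) r + δ (false , u , suc d) r
  split (true  , h , t) = sym (+-identityʳ _)
  split (false , h , t) = refl

-- (n ∸ m) C k, except that it vanishes for m > n rather than truncating the subtraction
binom∸ : ℕ → ℕ → ℕ → ℕ
binom∸ n       zero    k = n C k
binom∸ zero    (suc m) k = 0
binom∸ (suc n) (suc m) k = binom∸ n m k

binom∸-pascal : ∀ n m k → binom∸ (suc n) m (suc k) ≡ binom∸ n m k + binom∸ n m (suc k)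
binom∸-pascal n       zero          k = sym (nCk+nC[k+1]≡[n+1]C[k+1] n k)
binom∸-pascal zero    (suc zero)    k = refl
binom∸-pascal zero    (suc (suc m)) k = refl
binom∸-pascal (suc n) (suc m)       k = binom∸-pascal n m k

[1+2e]C[1+e]≡[1+2e]Ce : ∀ e → suc (e + e) C suc e ≡ suc (e + e) C e
[1+2e]C[1+e]≡[1+2e]Ce e =
  sym (trans (nCk≡nC[n∸k] (m≤n+m e (suc e))) (cong (suc (e + e) C_) (m+n∸n≡m (suc e) e)))

-- for n = 0 this counts the empty sequence, since lastIsHeads [] = false
count-false-zero : ∀ n u → count n (false , u , 0) ≡ 𝟙 (u ≡ᵇ 0)
count-false-zero zero    zero    = refl
count-false-zero zero    (suc u) = refl
count-false-zero (suc n) u       = trans (count-suc-false-zero n u) (count-false-zero n u)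

count-true : ∀ n u d → count n (true , u , d) ≡ ((u + d) C d) * binom∸ n (suc (u + d)) d
count-false-suc : ∀ n u d → count n (false , u , suc d) ≡ ((u + d) C d) * binom∸ n (suc (u + d)) (suc d)

count-true zero    u       d       = sym (*-zeroʳ ((u + d) C d))
count-true (suc n) zero    zero    = trans (count-suc-true-zero n 0) (count-false-zero n 0)
count-true (suc n) zero    (suc d) = begin
  count (suc n) (true , 0 , suc d)              ≡⟨ count-suc-true-zero n (suc d) ⟩
  count n (false , 0 , suc d)                   ≡⟨ count-false-suc n 0 d ⟩
  (d C d) * binom∸ n (suc d) (suc d)
    ≡⟨ cong (_* binom∸ n (suc d) (suc d)) (trans (nCn≡1 d) (sym (nCn≡1 (suc d)))) ⟩
  (suc d C suc d) * binom∸ n (suc d) (suc d)    ∎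
count-true (suc n) (suc u) zero    = begin
  count (suc n) (true , suc u , 0)                       ≡⟨ count-suc-true-suc n u 0 ⟩
  count n (true , u , 0) + count n (false , suc u , 0)
    ≡⟨ cong₂ _+_ (count-true n u 0) (count-false-zero n (suc u)) ⟩
  ((u + 0) C 0) * binom∸ n (suc (u + 0)) 0 + 0           ≡⟨ +-identityʳ _ ⟩
  ((u + 0) C 0) * binom∸ n (suc (u + 0)) 0               ∎
count-true (suc n) (suc u) (suc d) = begin
  count (suc n) (true , suc u , suc d)
    ≡⟨ count-suc-true-suc n u (suc d) ⟩
  count n (true , u , suc d) + count n (false , suc u , suc d)
    ≡⟨ cong₂ _+_ (count-true n u (suc d)) (count-false-suc n (suc u) d) ⟩
  ((u + suc d) C suc d) * binom∸ n (suc (u + suc d)) (suc d) + (m C d) * g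
    ≡⟨ cong (λ k → (k C suc d) * binom∸ n (suc k) (suc d) + (m C d) * g) (+-suc u d) ⟩
  (m C suc d) * g + (m C d) * g
    ≡⟨ *-distribʳ-+ g (m C suc d) (m C d) ⟨
  (m C suc d + m C d) * g
    ≡⟨ cong (_* g) (trans (+-comm (m C suc d) (m C d)) (nCk+nC[k+1]≡[n+1]C[k+1] m d)) ⟩
  (suc m C suc d) * g
    ≡⟨ cong (λ k → (suc k C suc d) * binom∸ n (suc k) (suc d)) (+-suc u d) ⟨
  (suc (u + suc d) C suc d) * binom∸ n (suc (u + suc d)) (suc d)
    ∎
  where
  m = suc (u + d)
  g = binom∸ n (suc m) (suc d)

count-false-suc zero    zero    d = sym (*-zeroʳ (d C d))
count-false-suc zero    (suc u) d = sym (*-zeroʳ ((suc u + d) C d))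
count-false-suc (suc n) u       d = begin
  count (suc n) (false , u , suc d)
    ≡⟨ count-suc-false-suc n u d ⟩
  count n (true , u , d) + count n (false , u , suc d)
    ≡⟨ cong₂ _+_ (count-true n u d) (count-false-suc n u d) ⟩
  ((u + d) C d) * binom∸ n (suc (u + d)) d + ((u + d) C d) * binom∸ n (suc (u + d)) (suc d)
    ≡⟨ *-distribˡ-+ ((u + d) C d) _ _ ⟨
  ((u + d) C d) * (binom∸ n (suc (u + d)) d + binom∸ n (suc (u + d)) (suc d))
    ≡⟨ cong (((u + d) C d) *_) (binom∸-pascal n (suc (u + d)) d) ⟨
  ((u + d) C d) * binom∸ (suc n) (suc (u + d)) (suc d)
    ∎

count-diagonal : ∀ n e →
  count (suc n) (true , e , suc e) ≡ count n (true , e , suc e) + count n (true , suc e , e)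
count-diagonal n e = begin
  count (suc n) (true , e , suc e)                 ≡⟨ count-below-diagonal (suc n) ⟩
  (m C suc e) * binom∸ (suc n) (suc m) (suc e)     ≡⟨ cong ((m C suc e) *_) (binom∸-pascal n (suc m) e) ⟩
  (m C suc e) * (a + b)                            ≡⟨ *-distribˡ-+ (m C suc e) a b ⟩
  (m C suc e) * a + (m C suc e) * b                ≡⟨ cong (λ c → c * a + (m C suc e) * b) ([1+2e]C[1+e]≡[1+2e]Ce e) ⟩
  (m C e) * a + (m C suc e) * b                    ≡⟨ +-comm ((m C e) * a) ((m C suc e) * b) ⟩
  (m C suc e) * b + (m C e) * a
    ≡⟨ cong₂ _+_ (count-below-diagonal n) (count-true n (suc e) e) ⟨
  count n (true , e , suc e) + count n (true , suc e , e)  ∎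
  where
  m = suc (e + e)
  a = binom∸ n (suc m) e
  b = binom∸ n (suc m) (suc e)
  count-below-diagonal : ∀ n → count n (true , e , suc e) ≡ (m C suc e) * binom∸ n (suc m) (suc e)
  count-below-diagonal n =
    trans (count-true n e (suc e)) (cong (λ k → (k C suc e) * binom∸ n (suc k) (suc e)) (+-suc e e))

≟true : ∀ b → does (b Bool.≟ true) ≡ b
≟true true  = refl
≟true false = refl

⊖≟-1 : ∀ m n → does (m ⊖ n ℤ.≟ -[1+ 0 ]) ≡ (n ≡ᵇ suc m)
⊖≟-1 zero    zero    = refl
⊖≟-1 zero    (suc n) = refl
⊖≟-1 (suc m) zero    = refl
⊖≟-1 (suc m) (suc n) = trans (cong (λ z → does (z ℤ.≟ -[1+ 0 ])) (ℤ.[1+m]⊖[1+n]≡m⊖n m n)) (⊖≟-1 m n)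

⊖≟1 : ∀ m n → does (m ⊖ n ℤ.≟ + 1) ≡ (m ≡ᵇ suc n)
⊖≟1 zero    zero    = refl
⊖≟1 zero    (suc n) = refl
⊖≟1 (suc m) zero    = refl
⊖≟1 (suc m) (suc n) = trans (cong (λ z → does (z ℤ.≟ + 1)) (ℤ.[1+m]⊖[1+n]≡m⊖n m n)) (⊖≟1 m n)

⊖<0 : ∀ m n → does (m ⊖ n ℤ.<? + 0) ≡ (m <ᵇ n)
⊖<0 zero    zero    = refl
⊖<0 zero    (suc n) = refl
⊖<0 (suc m) zero    = refl
⊖<0 (suc m) (suc n) = trans (cong (λ z → does (z ℤ.<? + 0)) (ℤ.[1+m]⊖[1+n]≡m⊖n m n)) (⊖<0 m n)

0<⊖ : ∀ m n → does (+ 0 ℤ.<? m ⊖ n) ≡ (n <ᵇ m)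
0<⊖ zero    zero    = refl
0<⊖ zero    (suc n) = refl
0<⊖ (suc m) zero    = refl
0<⊖ (suc m) (suc n) = trans (cong (λ z → does (+ 0 ℤ.<? z)) (ℤ.[1+m]⊖[1+n]≡m⊖n m n)) (0<⊖ m n)

h₄-weight h₂-weight : Weight
h₄-weight (l , h , t) = 𝟙 (l ∧ (t ≡ᵇ suc h))
h₂-weight (l , h , t) = 𝟙 (l ∧ (h ≡ᵇ suc t))

h₄≡total : ∀ n → h₄ n ≡ total n h₄-weight
h₄≡total n = length-filter≡total n _ h₄-weight λ x → cong 𝟙 (cong₂ _∧_ (≟true (lastIsHeads x))
  (trans (cong (λ z → does (z ℤ.≟ -[1+ 0 ])) (S≡#HH⊖#HT x)) (⊖≟-1 (#HH x) (#HT x))))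

h₂≡total : ∀ n → h₂ n ≡ total n h₂-weight
h₂≡total n = length-filter≡total n _ h₂-weight λ x → cong 𝟙 (cong₂ _∧_ (≟true (lastIsHeads x))
  (trans (cong (λ z → does (z ℤ.≟ + 1)) (S≡#HH⊖#HT x)) (⊖≟1 (#HH x) (#HT x))))

h₄≡∑< : ∀ n K → n < K → h₄ n ≡ ∑< K (λ e → count n (true , e , suc e))
h₄≡∑< n K n<K = begin
  h₄ n                                                   ≡⟨ h₄≡total n ⟩
  total n h₄-weight                                      ≡⟨ total-cong-≤ n split ⟩
  total n (λ s → ∑< K (λ e → δ (true , e , suc e) s))    ≡⟨ total-∑< n K (λ e → δ (true , e , suc e)) ⟩
  ∑< K (λ e → count n (true , e , suc e))                ∎
  where
  split : ∀ l h t → h ≤ n → t ≤ n → h₄-weight (l , h , t) ≡ ∑< K (λ e → δ (true , e , suc e) (l , h , t))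
  split true  h t h≤n _ = sym (∑<-δ (λ e → t ≡ᵇ suc e) (≤-<-trans h≤n n<K))
  split false h t _   _ = sym (∑<-zero K)

h₂≡∑< : ∀ n K → n < K → h₂ n ≡ ∑< K (λ e → count n (true , suc e , e))
h₂≡∑< n K n<K = begin
  h₂ n                                                   ≡⟨ h₂≡total n ⟩
  total n h₂-weight                                      ≡⟨ total-cong-≤ n split ⟩
  total n (λ s → ∑< K (λ e → δ (true , suc e , e) s))    ≡⟨ total-∑< n K (λ e → δ (true , suc e , e)) ⟩
  ∑< K (λ e → count n (true , suc e , e))                ∎
  where
  split : ∀ l h t → h ≤ n → t ≤ n → h₂-weight (l , h , t) ≡ ∑< K (λ e → δ (true , suc e , e) (l , h , t))
  split true  h t _ t≤n = sym (trans (∑<-cong K (λ e → cong 𝟙 (Bool.∧-comm (h ≡ᵇ suc e) (t ≡ᵇ e))))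
                                     (∑<-δ (λ e → h ≡ᵇ suc e) (≤-<-trans t≤n n<K)))
  split false h t _ _   = sym (∑<-zero K)

h₄-suc : ∀ n → h₄ (suc n) ≡ h₄ n + h₂ n
h₄-suc n = begin
  h₄ (suc n)                              ≡⟨ h₄≡∑< (suc n) K (n<1+n (suc n)) ⟩
  ∑< K (λ e → count (suc n) (true , e , suc e))
                                          ≡⟨ ∑<-cong K (count-diagonal n) ⟩
  ∑< K (λ e → below e + above e)          ≡⟨ ∑<-+ K below above ⟩
  ∑< K below + ∑< K above                 ≡⟨ cong₂ _+_ (h₄≡∑< n K n<K) (h₂≡∑< n K n<K) ⟨
  h₄ n + h₂ n                             ∎
  where
  K = suc (suc n)
  n<K = m<n⇒m<1+n (n<1+n n)
  below above : ℕ → ℕ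
  below e = count n (true , e , suc e)
  above e = count n (true , suc e , e)

negative positive tie : Weight
negative (l , h , t) = 𝟙 (h <ᵇ t)
positive (l , h , t) = 𝟙 (t <ᵇ h)
tie (l , h , t) = 𝟙 (l ∧ (h ≡ᵇ t))

D≡total : ∀ n → D n ≡ + total n negative - + total n positive
D≡total n = cong₂ (λ a b → + a - + b)
  (length-filter≡total n _ negative λ x →
    cong 𝟙 (trans (cong (λ z → does (z ℤ.<? + 0)) (S≡#HH⊖#HT x)) (⊖<0 (#HH x) (#HT x))))
  (length-filter≡total n _ positive λ x →
    cong 𝟙 (trans (cong (λ z → does (+ 0 ℤ.<? z)) (S≡#HH⊖#HT x)) (0<⊖ (#HH x) (#HT x))))

total-doubling : ∀ n (F G T : Weight) → (∀ s → transfer F s + G s ≡ F s + F s + T s) →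
                 total (suc n) F + total n G ≡ total n F + total n F + total n T
total-doubling n F G T split = begin
  total (suc n) F + total n G              ≡⟨ cong (_+ total n G) (total-transfer n F) ⟩
  total n (transfer F) + total n G         ≡⟨ total-+ n (transfer F) G ⟨
  total n (λ s → transfer F s + G s)       ≡⟨ total-cong n split ⟩
  total n (λ s → F s + F s + T s)          ≡⟨ total-+ n (λ s → F s + F s) T ⟩
  total n (λ s → F s + F s) + total n T    ≡⟨ cong (_+ total n T) (total-+ n F F) ⟩
  total n F + total n F + total n T        ∎

transfer-negative : ∀ s → transfer negative s + h₄-weight s ≡ negative s + negative s + tie s
transfer-negative (true  , h , t) = crossing h t
  where
  crossing : ∀ h t →
    𝟙 (suc h <ᵇ t) + 𝟙 (h <ᵇ suc t) + 𝟙 (t ≡ᵇ suc h) ≡ 𝟙 (h <ᵇ t) + 𝟙 (h <ᵇ t) + 𝟙 (h ≡ᵇ t)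
  crossing zero    zero          = refl
  crossing zero    (suc zero)    = refl
  crossing zero    (suc (suc t)) = refl
  crossing (suc h) zero          = refl
  crossing (suc h) (suc t)       = crossing h t
transfer-negative (false , h , t) = refl

transfer-positive : ∀ s → transfer positive s + h₂-weight s ≡ positive s + positive s + tie s
transfer-positive (true  , h , t) = crossing h t
  where
  crossing : ∀ h t →
    𝟙 (t <ᵇ suc h) + 𝟙 (suc t <ᵇ h) + 𝟙 (h ≡ᵇ suc t) ≡ 𝟙 (t <ᵇ h) + 𝟙 (t <ᵇ h) + 𝟙 (h ≡ᵇ t)
  crossing zero          zero    = refl
  crossing zero          (suc t) = refl
  crossing (suc zero)    zero    = refl
  crossing (suc (suc h)) zero    = refl
  crossing (suc h)       (suc t) = crossing h t
transfer-positive (false , h , t) = refl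

difference-doubling : ∀ {N′ P′ N P a b c : ℕ} → N′ + a ≡ N + N + c → P′ + b ≡ P + P + c →
                      + N′ - + P′ ≡ (+ N - + P) +ℤ (+ N - + P) - + a +ℤ + b
difference-doubling {N′} {P′} {N} {P} {a} {b} {c} eN eP = begin
  + N′ - + P′                                               ≡⟨ unfold (+ N′) (+ P′) (+ a) (+ b) ⟩
  + (N′ + a) - + (P′ + b) - + a +ℤ + b                      ≡⟨ cong₂ (λ x y → + x - + y - + a +ℤ + b) eN eP ⟩
  + (N + N + c) - + (P + P + c) - + a +ℤ + b                ≡⟨ cancel (+ N) (+ P) (+ a) (+ b) (+ c) ⟩
  (+ N - + P) +ℤ (+ N - + P) - + a +ℤ + b                   ∎
  where
  unfold : ∀ (x y a b : ℤ) → x - y ≡ (x +ℤ a) - (y +ℤ b) - a +ℤ b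
  unfold = solve-∀
  cancel : ∀ (x y a b c : ℤ) → (x +ℤ x +ℤ c) - (y +ℤ y +ℤ c) - a +ℤ b ≡ (x - y) +ℤ (x - y) - a +ℤ b
  cancel = solve-∀

D-suc : ∀ n → D (suc n) ≡ D n +ℤ D n - + h₄ n +ℤ + h₂ n
D-suc n = begin
  D (suc n)                                        ≡⟨ D≡total (suc n) ⟩
  + total (suc n) negative - + total (suc n) positive
                                                   ≡⟨ difference-doubling {N = N} {P = P} negatives positives ⟩
  (+ N - + P) +ℤ (+ N - + P) - + h₄ n +ℤ + h₂ n    ≡⟨ cong (λ d → d +ℤ d - + h₄ n +ℤ + h₂ n) (D≡total n) ⟨
  D n +ℤ D n - + h₄ n +ℤ + h₂ n                    ∎
  where
  N = total n negative
  P = total n positive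
  negatives : total (suc n) negative + h₄ n ≡ N + N + total n tie
  negatives = trans (cong (_+_ (total (suc n) negative)) (h₄≡total n))
                    (total-doubling n negative h₄-weight tie transfer-negative)
  positives : total (suc n) positive + h₂ n ≡ P + P + total n tie
  positives = trans (cong (_+_ (total (suc n) positive)) (h₂≡total n))
                    (total-doubling n positive h₂-weight tie transfer-positive)

D≡h₄ : ∀ n → D n ≡ + h₄ n
D≡h₄ zero    = refl
D≡h₄ (suc n) = begin
  D (suc n)                                 ≡⟨ D-suc n ⟩
  D n +ℤ D n - + h₄ n +ℤ + h₂ n             ≡⟨ cong (λ d → d +ℤ d - + h₄ n +ℤ + h₂ n) (D≡h₄ n) ⟩
  + h₄ n +ℤ + h₄ n - + h₄ n +ℤ + h₂ n       ≡⟨ cancel (+ h₄ n) (+ h₂ n) ⟩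
  + (h₄ n + h₂ n)                           ≡⟨ cong +_ (h₄-suc n) ⟨
  + h₄ (suc n)                              ∎
  where
  cancel : ∀ (x y : ℤ) → x +ℤ x - x +ℤ y ≡ x +ℤ y
  cancel = solve-∀

theorem1 : (n : ℕ) → n ≥ 2 → (D n ≡ + h₄ n) × (D (suc n) - D n ≡ + h₂ n)
theorem1 n _ = D≡h₄ n , (begin
  D (suc n) - D n                ≡⟨ cong₂ _-_ (D≡h₄ (suc n)) (D≡h₄ n) ⟩
  + h₄ (suc n) - + h₄ n          ≡⟨ cong (λ k → + k - + h₄ n) (h₄-suc n) ⟩
  + h₄ n +ℤ + h₂ n - + h₄ n      ≡⟨ cancel (+ h₄ n) (+ h₂ n) ⟩
  + h₂ n                         ∎)
  where
  cancel : ∀ (x y : ℤ) → x +ℤ y - x ≡ y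
  cancel = solve-∀
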